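{- For every integer $p \ge 0$ and every integer $n\ge 0$, $$\sum_{k=0}^n s(n,k)\,(-1)^k\, k\, p^{k-1} = (-1)^n\, n!\, h_n^{(p)},\qquad\text{equivalently}\qquad h_n^{(p)} = \frac{1}{n!}\sum_{k=0}^n s(n,k)(-1)^{n-k} k\, p^{k-1}.$$ In particular, for $p=1$, $\sum_{k=0}^n s(n,k)(-1)^k k = (-1)^n n!\, H_n$.
   Context: $s(n,k)$ denotes the (signed) Stirling numbers of the first kind, defined by $x(x-1)\cdots(x-n+1) = \sum_{k=0}^n s(n,k)x^k$. $H_n = 1+\tfrac12+\dots+\tfrac1n$ ($H_0=0$). For integer $p\ge0$, the hyperharmonic numbers $h_n^{(p)}$ are defined by $\frac{ -\ln(1-t)}{(1-t)^p} = \sum_{n\ge0} h_n^{(p)} t^n$; so $h_n^{(1)}=H_n$, $h_n^{(p+1)}=h_1^{(p)}+\dots+h_n^{(p)}$, $h_0^{(p)}=0$. The term with $k=0$ is $0$ (it carries the factor $k$), and $0^0=1$. -}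

module Defs where

open import Data.Nat as ℕ using (ℕ; zero; suc)
open import Data.Integer as ℤ using (ℤ)
open import Data.Rational as ℚ using (ℚ)

-- signed Stirling numbers of the first kind s(n,k), via
-- x(x-1)...(x-n) = (x-n) * x(x-1)...(x-n+1):
-- s(0,0)=1, s(0,k+1)=0, s(n+1,0)=0, s(n+1,k+1) = s(n,k) - n s(n,k+1)
stirling1 : ℕ → ℕ → ℤ
stirling1 zero    zero    = ℤ.1ℤ
stirling1 zero    (suc k) = ℤ.0ℤ
stirling1 (suc n) zero    = ℤ.0ℤ
stirling1 (suc n) (suc k) = stirling1 n k ℤ.- (ℤ.+ n ℤ.* stirling1 n (suc k))

Σ≤ : ℕ → (ℕ → ℚ) → ℚ
Σ≤ zero    f = f 0
Σ≤ (suc n) f = Σ≤ n f ℚ.+ f (suc n)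

-- coefficients of -ln(1-t) = Σ_{n≥1} t^n / n  (h^{(0)}_n, with h^{(0)}_0 = 0)
invOrZero : ℕ → ℚ
invOrZero zero    = ℚ.0ℚ
invOrZero (suc m) = ℤ.1ℤ ℚ./ suc m

-- hyperharmonic numbers h_n^{(p)}: coefficients of -ln(1-t)/(1-t)^p;
-- dividing by (1-t) takes partial sums, so h^{(p+1)}_n = Σ_{j=0}^{n} h^{(p)}_j
hyperharmonic : ℕ → ℕ → ℚ
hyperharmonic zero    n = invOrZero n
hyperharmonic (suc p) n = Σ≤ n (hyperharmonic p)

toℚ : ℤ → ℚ
toℚ z = z ℚ./ 1

sgn : ℕ → ℤ
sgn zero    = ℤ.1ℤ
sgn (suc k) = ℤ.- sgn k

-- Σₖ s(n,k) xᵏ is the falling factorial x(x−1)⋯(x−n+1). Differentiating in x and putting x = −p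
-- turns the left-hand side into the sum of the theorem and the right-hand side into (−1)ⁿ times the
-- derivative D(p,n) of the rising factorial p(p+1)⋯(p+n−1). Peeling off the factor p gives
-- D(0,n+1) = n! and D(p+1,n+1) = (n+1)·D(p+1,n) + D(p,n+1), which is exactly the recursion satisfied
-- by n!·h_n^(p), because h_(n+1)^(p+1) = h_n^(p+1) + h_(n+1)^(p) and h_(n+1)^(0) = 1/(n+1).

module Submission where

open import Defs
open import Data.Nat as ℕ using (ℕ; zero; suc; _<_; _∸_; _!; s≤s)
open import Data.Integer as ℤ using (ℤ; +_; -_; _+_; _-_; _*_; _^_; 0ℤ; 1ℤ)
open import Data.Rational as ℚ using (ℚ)
open import Relation.Binary.PropositionalEquality
  using (_≡_; refl; sym; trans; cong; cong₂; module ≡-Reasoning)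
import Data.Nat.Properties as ℕ
import Data.Integer.Properties as ℤ
import Data.Rational.Properties as ℚ
import Data.Rational.Unnormalised as ℚᵘ
import Data.Rational.Unnormalised.Properties as ℚᵘ
open import Algebra.Properties.CommutativeSemigroup ℤ.+-commutativeSemigroup using (interchange)
open import Algebra.Properties.CommutativeSemigroup ℤ.*-commutativeSemigroup using (x∙yz≈y∙xz)
import Data.Nat.Tactic.RingSolver as ℕ-Solver
open import Data.Integer.Tactic.RingSolver using (solve-∀)

toℚᵘ-toℚ : ∀ z → ℚ.toℚᵘ (toℚ z) ℚᵘ.≃ ℚᵘ.mkℚᵘ z 0
toℚᵘ-toℚ z = ℚ.toℚᵘ-fromℚᵘ (ℚᵘ.mkℚᵘ z 0)

toℚ-homo-+ : ∀ a b → toℚ (a ℤ.+ b) ≡ toℚ a ℚ.+ toℚ b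
toℚ-homo-+ a b = ℚ.toℚᵘ-injective (begin
  ℚ.toℚᵘ (toℚ (a ℤ.+ b))             ≈⟨ toℚᵘ-toℚ (a ℤ.+ b) ⟩
  ℚᵘ.mkℚᵘ (a ℤ.+ b) 0                 ≈⟨ ℚᵘ.*≡* (cross a b) ⟩
  ℚᵘ.mkℚᵘ a 0 ℚᵘ.+ ℚᵘ.mkℚᵘ b 0        ≈⟨ ℚᵘ.+-cong (toℚᵘ-toℚ a) (toℚᵘ-toℚ b) ⟨
  ℚ.toℚᵘ (toℚ a) ℚᵘ.+ ℚ.toℚᵘ (toℚ b) ≈⟨ ℚ.toℚᵘ-homo-+ (toℚ a) (toℚ b) ⟨
  ℚ.toℚᵘ (toℚ a ℚ.+ toℚ b)           ∎)
  where
  open ℚᵘ.≃-Reasoning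
  cross : ∀ a b → (a ℤ.+ b) ℤ.* ℤ.1ℤ ≡ (a ℤ.* ℤ.1ℤ ℤ.+ b ℤ.* ℤ.1ℤ) ℤ.* ℤ.1ℤ
  cross = solve-∀

toℚ-homo-* : ∀ a b → toℚ (a ℤ.* b) ≡ toℚ a ℚ.* toℚ b
toℚ-homo-* a b = ℚ.toℚᵘ-injective (begin
  ℚ.toℚᵘ (toℚ (a ℤ.* b))             ≈⟨ toℚᵘ-toℚ (a ℤ.* b) ⟩
  ℚᵘ.mkℚᵘ (a ℤ.* b) 0                 ≈⟨ ℚᵘ.≃-refl ⟩
  ℚᵘ.mkℚᵘ a 0 ℚᵘ.* ℚᵘ.mkℚᵘ b 0        ≈⟨ ℚᵘ.*-cong (toℚᵘ-toℚ a) (toℚᵘ-toℚ b) ⟨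
  ℚ.toℚᵘ (toℚ a) ℚᵘ.* ℚ.toℚᵘ (toℚ b) ≈⟨ ℚ.toℚᵘ-homo-* (toℚ a) (toℚ b) ⟨
  ℚ.toℚᵘ (toℚ a ℚ.* toℚ b)           ∎)
  where open ℚᵘ.≃-Reasoning

toℚ-pos-+ : ∀ m n → toℚ (+ (m ℕ.+ n)) ≡ toℚ (+ m) ℚ.+ toℚ (+ n)
toℚ-pos-+ m n = trans (cong toℚ (ℤ.pos-+ m n)) (toℚ-homo-+ (+ m) (+ n))

toℚ-pos-* : ∀ m n → toℚ (+ (m ℕ.* n)) ≡ toℚ (+ m) ℚ.* toℚ (+ n)
toℚ-pos-* m n = trans (cong toℚ (ℤ.pos-* m n)) (toℚ-homo-* (+ m) (+ n))

Σℤ≤ : ℕ → (ℕ → ℤ) → ℤ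
Σℤ≤ zero    f = f 0
Σℤ≤ (suc n) f = Σℤ≤ n f + f (suc n)

Σℤ≤-cong : ∀ n {f g : ℕ → ℤ} → (∀ k → f k ≡ g k) → Σℤ≤ n f ≡ Σℤ≤ n g
Σℤ≤-cong zero    f≗g = f≗g 0
Σℤ≤-cong (suc n) f≗g = cong₂ _+_ (Σℤ≤-cong n f≗g) (f≗g (suc n))

Σℤ≤-suc : ∀ n (f : ℕ → ℤ) → Σℤ≤ (suc n) f ≡ f 0 + Σℤ≤ n (λ k → f (suc k))
Σℤ≤-suc zero    f = refl
Σℤ≤-suc (suc n) f = trans (cong (_+ f (2 ℕ.+ n)) (Σℤ≤-suc n f)) (ℤ.+-assoc (f 0) _ _)

Σℤ≤-distrib-+ : ∀ n (f g : ℕ → ℤ) → Σℤ≤ n (λ k → f k + g k) ≡ Σℤ≤ n f + Σℤ≤ n g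
Σℤ≤-distrib-+ zero    f g = refl
Σℤ≤-distrib-+ (suc n) f g =
  trans (cong (_+ (f (suc n) + g (suc n))) (Σℤ≤-distrib-+ n f g))
        (interchange (Σℤ≤ n f) (Σℤ≤ n g) (f (suc n)) (g (suc n)))

*-distribˡ-Σℤ≤ : ∀ n c (f : ℕ → ℤ) → Σℤ≤ n (λ k → c * f k) ≡ c * Σℤ≤ n f
*-distribˡ-Σℤ≤ zero    c f = refl
*-distribˡ-Σℤ≤ (suc n) c f =
  trans (cong (_+ c * f (suc n)) (*-distribˡ-Σℤ≤ n c f)) (sym (ℤ.*-distribˡ-+ c _ _))

neg-distrib-Σℤ≤ : ∀ n (f : ℕ → ℤ) → Σℤ≤ n (λ k → - f k) ≡ - Σℤ≤ n f
neg-distrib-Σℤ≤ zero    f = refl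
neg-distrib-Σℤ≤ (suc n) f =
  trans (cong (_+ - f (suc n)) (neg-distrib-Σℤ≤ n f))
        (sym (ℤ.neg-distrib-+ (Σℤ≤ n f) (f (suc n))))

toℚ-Σℤ≤ : ∀ n (f : ℕ → ℤ) → Σ≤ n (λ k → toℚ (f k)) ≡ toℚ (Σℤ≤ n f)
toℚ-Σℤ≤ zero    f = refl
toℚ-Σℤ≤ (suc n) f =
  trans (cong (ℚ._+ toℚ (f (suc n))) (toℚ-Σℤ≤ n f)) (sym (toℚ-homo-+ (Σℤ≤ n f) (f (suc n))))

stirling1-above : ∀ {n k} → n < k → stirling1 n k ≡ 0ℤ
stirling1-above {zero}  {suc k} _         = refl
stirling1-above {suc n} {suc k} (s≤s n<k) = begin
  stirling1 n k - + n * stirling1 n (suc k)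
    ≡⟨ cong₂ (λ a b → a - + n * b) (stirling1-above n<k) (stirling1-above (ℕ.m<n⇒m<1+n n<k)) ⟩
  0ℤ - + n * 0ℤ
    ≡⟨ cong (λ m → 0ℤ - m) (ℤ.*-zeroʳ (+ n)) ⟩
  0ℤ
    ∎
  where open ≡-Reasoning

stirlingSum : ℕ → (ℕ → ℤ) → ℤ
stirlingSum n g = Σℤ≤ n (λ k → stirling1 n k * g k)

-- The factor n matters only for n = 0, where s(0,0) = 1 is the term that the shift drops.
stirlingSum-shift : ∀ n (g : ℕ → ℤ) →
  + n * Σℤ≤ n (λ j → stirling1 n (suc j) * g (suc j)) ≡ + n * stirlingSum n g
stirlingSum-shift zero    g = refl
stirlingSum-shift (suc m) g = cong (+ suc m *_) (begin
  Σℤ≤ (suc m) h                                  ≡⟨ cong (_+_ (Σℤ≤ m h)) top-vanishes ⟩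
  Σℤ≤ m h + 0ℤ                                   ≡⟨ ℤ.+-identityʳ (Σℤ≤ m h) ⟩
  Σℤ≤ m h                                        ≡⟨ ℤ.+-identityˡ (Σℤ≤ m h) ⟨
  0ℤ * g 0 + Σℤ≤ m h                             ≡⟨ Σℤ≤-suc m (λ k → stirling1 (suc m) k * g k) ⟨
  stirlingSum (suc m) g                          ∎)
  where
  open ≡-Reasoning
  h : ℕ → ℤ
  h j = stirling1 (suc m) (suc j) * g (suc j)
  top-vanishes : h (suc m) ≡ 0ℤ
  top-vanishes = cong (_* g (2 ℕ.+ m)) (stirling1-above (ℕ.n<1+n (suc m)))

stirlingSum-suc : ∀ n (g : ℕ → ℤ) →
  stirlingSum (suc n) g ≡ stirlingSum n (λ k → g (suc k)) - + n * stirlingSum n g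
stirlingSum-suc n g = begin
  stirlingSum (suc n) g
    ≡⟨ Σℤ≤-suc n (λ k → stirling1 (suc n) k * g k) ⟩
  0ℤ * g 0 + Σℤ≤ n (λ j → (stirling1 n j - + n * stirling1 n (suc j)) * g (suc j))
    ≡⟨ ℤ.+-identityˡ _ ⟩
  Σℤ≤ n (λ j → (stirling1 n j - + n * stirling1 n (suc j)) * g (suc j))
    ≡⟨ Σℤ≤-cong n (λ j → expand (stirling1 n j) (+ n) (stirling1 n (suc j)) (g (suc j))) ⟩
  Σℤ≤ n (λ j → stirling1 n j * g (suc j) + (- + n) * (stirling1 n (suc j) * g (suc j)))
    ≡⟨ Σℤ≤-distrib-+ n _ _ ⟩
  stirlingSum n (λ k → g (suc k)) + Σℤ≤ n (λ j → (- + n) * (stirling1 n (suc j) * g (suc j)))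
    ≡⟨ cong (_+_ (stirlingSum n (λ k → g (suc k))))
            (trans (*-distribˡ-Σℤ≤ n (- + n) _) (sym (ℤ.neg-distribˡ-* (+ n) _))) ⟩
  stirlingSum n (λ k → g (suc k)) - + n * Σℤ≤ n (λ j → stirling1 n (suc j) * g (suc j))
    ≡⟨ cong (λ t → stirlingSum n (λ k → g (suc k)) - t) (stirlingSum-shift n g) ⟩
  stirlingSum n (λ k → g (suc k)) - + n * stirlingSum n g
    ∎
  where
  open ≡-Reasoning
  expand : ∀ s N t G → (s - N * t) * G ≡ s * G + (- N) * (t * G)
  expand = solve-∀

stirlingSum-distrib-+ : ∀ n (f g : ℕ → ℤ) →
  stirlingSum n (λ k → f k + g k) ≡ stirlingSum n f + stirlingSum n g
stirlingSum-distrib-+ n f g =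
  trans (Σℤ≤-cong n (λ k → ℤ.*-distribˡ-+ (stirling1 n k) (f k) (g k))) (Σℤ≤-distrib-+ n _ _)

*-distribˡ-stirlingSum : ∀ n c (g : ℕ → ℤ) → stirlingSum n (λ k → c * g k) ≡ c * stirlingSum n g
*-distribˡ-stirlingSum n c g =
  trans (Σℤ≤-cong n (λ k → x∙yz≈y∙xz (stirling1 n k) c (g k))) (*-distribˡ-Σℤ≤ n c _)

-- Primed functions are derivatives in x, unfolded by the product rule.
pow′ : ℤ → ℕ → ℤ
pow′ x k = + k * x ^ (k ∸ 1)

fallingFactorial : ℤ → ℕ → ℤ
fallingFactorial x zero    = 1ℤ
fallingFactorial x (suc n) = (x - + n) * fallingFactorial x n

fallingFactorial′ : ℤ → ℕ → ℤ
fallingFactorial′ x zero    = 0ℤ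
fallingFactorial′ x (suc n) = fallingFactorial x n + (x - + n) * fallingFactorial′ x n

pow′-suc : ∀ x k → pow′ x (suc k) ≡ x ^ k + x * pow′ x k
pow′-suc x zero    = sym (cong (_+_ 1ℤ) (ℤ.*-zeroʳ x))
pow′-suc x (suc k) =
  trans (cong (_* (x * x ^ k)) (ℤ.pos-+ 1 (suc k))) (product-rule (+ suc k) x (x ^ k))
  where
  product-rule : ∀ K x y → (1ℤ + K) * (x * y) ≡ x * y + x * (K * y)
  product-rule = solve-∀

stirlingSum-^ : ∀ n x → stirlingSum n (x ^_) ≡ fallingFactorial x n
stirlingSum-^ zero    x = refl
stirlingSum-^ (suc n) x = begin
  stirlingSum (suc n) (x ^_)
    ≡⟨ stirlingSum-suc n (x ^_) ⟩
  stirlingSum n (λ k → x * x ^ k) - + n * stirlingSum n (x ^_)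
    ≡⟨ cong (λ t → t - + n * stirlingSum n (x ^_)) (*-distribˡ-stirlingSum n x (x ^_)) ⟩
  x * stirlingSum n (x ^_) - + n * stirlingSum n (x ^_)
    ≡⟨ cong (λ F → x * F - + n * F) (stirlingSum-^ n x) ⟩
  x * fallingFactorial x n - + n * fallingFactorial x n
    ≡⟨ factor x (+ n) (fallingFactorial x n) ⟩
  fallingFactorial x (suc n)
    ∎
  where
  open ≡-Reasoning
  factor : ∀ x N F → x * F - N * F ≡ (x - N) * F
  factor = solve-∀

stirlingSum-pow′ : ∀ n x → stirlingSum n (pow′ x) ≡ fallingFactorial′ x n
stirlingSum-pow′ zero    x = refl
stirlingSum-pow′ (suc n) x = begin
  stirlingSum (suc n) (pow′ x)
    ≡⟨ stirlingSum-suc n (pow′ x) ⟩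
  stirlingSum n (λ k → pow′ x (suc k)) - + n * stirlingSum n (pow′ x)
    ≡⟨ cong (λ t → t - + n * stirlingSum n (pow′ x)) shifted ⟩
  stirlingSum n (x ^_) + x * stirlingSum n (pow′ x) - + n * stirlingSum n (pow′ x)
    ≡⟨ cong₂ (λ F D → F + x * D - + n * D) (stirlingSum-^ n x) (stirlingSum-pow′ n x) ⟩
  fallingFactorial x n + x * fallingFactorial′ x n - + n * fallingFactorial′ x n
    ≡⟨ factor x (+ n) (fallingFactorial x n) (fallingFactorial′ x n) ⟩
  fallingFactorial′ x (suc n)
    ∎
  where
  open ≡-Reasoning
  shifted : stirlingSum n (λ k → pow′ x (suc k)) ≡ stirlingSum n (x ^_) + x * stirlingSum n (pow′ x)
  shifted = begin
    stirlingSum n (λ k → pow′ x (suc k))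
      ≡⟨ Σℤ≤-cong n (λ k → cong (stirling1 n k *_) (pow′-suc x k)) ⟩
    stirlingSum n (λ k → x ^ k + x * pow′ x k)
      ≡⟨ stirlingSum-distrib-+ n (x ^_) (λ k → x * pow′ x k) ⟩
    stirlingSum n (x ^_) + stirlingSum n (λ k → x * pow′ x k)
      ≡⟨ cong (_+_ (stirlingSum n (x ^_))) (*-distribˡ-stirlingSum n x (pow′ x)) ⟩
    stirlingSum n (x ^_) + x * stirlingSum n (pow′ x)
      ∎
  factor : ∀ x N F D → F + x * D - N * D ≡ F + (x - N) * D
  factor = solve-∀

risingFactorial : ℕ → ℕ → ℕ
risingFactorial x zero    = 1
risingFactorial x (suc n) = (x ℕ.+ n) ℕ.* risingFactorial x n

risingFactorial′ : ℕ → ℕ → ℕ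
risingFactorial′ x zero    = 0
risingFactorial′ x (suc n) = risingFactorial x n ℕ.+ (x ℕ.+ n) ℕ.* risingFactorial′ x n

pos-+-* : ∀ x n r → (+ x + + n) * + r ≡ + ((x ℕ.+ n) ℕ.* r)
pos-+-* x n r = trans (cong (_* + r) (sym (ℤ.pos-+ x n))) (sym (ℤ.pos-* (x ℕ.+ n) r))

neg-^ : ∀ p k → (- + p) ^ k ≡ sgn k * + (p ℕ.^ k)
neg-^ p zero    = refl
neg-^ p (suc k) = begin
  (- + p) * (- + p) ^ k          ≡⟨ cong ((- + p) *_) (neg-^ p k) ⟩
  (- + p) * (sgn k * + (p ℕ.^ k))  ≡⟨ rearrange (+ p) (sgn k) (+ (p ℕ.^ k)) ⟩
  - sgn k * (+ p * + (p ℕ.^ k))    ≡⟨ cong (- sgn k *_) (ℤ.pos-* p (p ℕ.^ k)) ⟨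
  - sgn k * + (p ℕ.^ suc k)      ∎
  where
  open ≡-Reasoning
  rearrange : ∀ P s Q → (- P) * (s * Q) ≡ - s * (P * Q)
  rearrange = solve-∀

fallingFactorial-neg : ∀ x n → fallingFactorial (- + x) n ≡ sgn n * + risingFactorial x n
fallingFactorial-neg x zero    = refl
fallingFactorial-neg x (suc n) = begin
  (- + x - + n) * fallingFactorial (- + x) n ≡⟨ cong ((- + x - + n) *_) (fallingFactorial-neg x n) ⟩
  (- + x - + n) * (sgn n * + R)              ≡⟨ rearrange (+ x) (+ n) (sgn n) (+ R) ⟩
  - sgn n * ((+ x + + n) * + R)              ≡⟨ cong (- sgn n *_) (pos-+-* x n R) ⟩
  - sgn n * + risingFactorial x (suc n)      ∎
  where
  open ≡-Reasoning
  R = risingFactorial x n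
  rearrange : ∀ X N s R → (- X - N) * (s * R) ≡ - s * ((X + N) * R)
  rearrange = solve-∀

fallingFactorial′-neg : ∀ x n → fallingFactorial′ (- + x) n ≡ - (sgn n * + risingFactorial′ x n)
fallingFactorial′-neg x zero    = refl
fallingFactorial′-neg x (suc n) = begin
  fallingFactorial (- + x) n + (- + x - + n) * fallingFactorial′ (- + x) n
    ≡⟨ cong₂ (λ F D → F + (- + x - + n) * D) (fallingFactorial-neg x n) (fallingFactorial′-neg x n) ⟩
  sgn n * + R + (- + x - + n) * - (sgn n * + D)
    ≡⟨ rearrange (+ x) (+ n) (sgn n) (+ R) (+ D) ⟩
  - (- sgn n * (+ R + (+ x + + n) * + D))
    ≡⟨ cong (λ t → - (- sgn n * (+ R + t))) (pos-+-* x n D) ⟩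
  - (- sgn n * (+ R + + ((x ℕ.+ n) ℕ.* D)))
    ≡⟨ cong (λ t → - (- sgn n * t)) (ℤ.pos-+ R ((x ℕ.+ n) ℕ.* D)) ⟨
  - (sgn (suc n) * + risingFactorial′ x (suc n))
    ∎
  where
  open ≡-Reasoning
  R = risingFactorial x n
  D = risingFactorial′ x n
  rearrange : ∀ X N s R D → s * R + (- X - N) * - (s * D) ≡ - (- s * (R + (X + N) * D))
  rearrange = solve-∀

sgn-*-pow′ : ∀ p k → sgn k * + (k ℕ.* p ℕ.^ (k ∸ 1)) ≡ - pow′ (- + p) k
sgn-*-pow′ p zero    = refl
sgn-*-pow′ p (suc k) = begin
  - sgn k * + (suc k ℕ.* p ℕ.^ k)     ≡⟨ cong (- sgn k *_) (ℤ.pos-* (suc k) (p ℕ.^ k)) ⟩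
  - sgn k * (+ suc k * + (p ℕ.^ k))   ≡⟨ rearrange (sgn k) (+ suc k) (+ (p ℕ.^ k)) ⟩
  - (+ suc k * (sgn k * + (p ℕ.^ k))) ≡⟨ cong (λ t → - (+ suc k * t)) (neg-^ p k) ⟨
  - pow′ (- + p) (suc k)                ∎
  where
  open ≡-Reasoning
  rearrange : ∀ s K P → - s * (K * P) ≡ - (K * (s * P))
  rearrange = solve-∀

signed-stirling-sum≡risingFactorial′ : ∀ n p →
  Σℤ≤ n (λ k → stirling1 n k * sgn k * + (k ℕ.* p ℕ.^ (k ∸ 1))) ≡ sgn n * + risingFactorial′ p n
signed-stirling-sum≡risingFactorial′ n p = begin
  Σℤ≤ n (λ k → stirling1 n k * sgn k * + (k ℕ.* p ℕ.^ (k ∸ 1)))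
    ≡⟨ Σℤ≤-cong n summand ⟩
  Σℤ≤ n (λ k → - (stirling1 n k * pow′ (- + p) k))
    ≡⟨ neg-distrib-Σℤ≤ n (λ k → stirling1 n k * pow′ (- + p) k) ⟩
  - stirlingSum n (pow′ (- + p))
    ≡⟨ cong -_ (trans (stirlingSum-pow′ n (- + p)) (fallingFactorial′-neg p n)) ⟩
  - - (sgn n * + risingFactorial′ p n)
    ≡⟨ ℤ.neg-involutive _ ⟩
  sgn n * + risingFactorial′ p n
    ∎
  where
  open ≡-Reasoning
  summand : ∀ k →
    stirling1 n k * sgn k * + (k ℕ.* p ℕ.^ (k ∸ 1)) ≡ - (stirling1 n k * pow′ (- + p) k)
  summand k = begin
    stirling1 n k * sgn k * + (k ℕ.* p ℕ.^ (k ∸ 1))   ≡⟨ ℤ.*-assoc (stirling1 n k) (sgn k) _ ⟩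
    stirling1 n k * (sgn k * + (k ℕ.* p ℕ.^ (k ∸ 1))) ≡⟨ cong (stirling1 n k *_) (sgn-*-pow′ p k) ⟩
    stirling1 n k * - pow′ (- + p) k                  ≡⟨ ℤ.neg-distribʳ-* (stirling1 n k) _ ⟨
    - (stirling1 n k * pow′ (- + p) k)                ∎

risingFactorial-unfoldˡ : ∀ x n → risingFactorial x (suc n) ≡ x ℕ.* risingFactorial (suc x) n
risingFactorial-unfoldˡ x zero    = cong (ℕ._* 1) (ℕ.+-identityʳ x)
risingFactorial-unfoldˡ x (suc n) =
  trans (cong ((x ℕ.+ suc n) ℕ.*_) (risingFactorial-unfoldˡ x n))
        (reassoc x n (risingFactorial (suc x) n))
  where
  reassoc : ∀ x n r → (x ℕ.+ suc n) ℕ.* (x ℕ.* r) ≡ x ℕ.* ((suc x ℕ.+ n) ℕ.* r)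
  reassoc = ℕ-Solver.solve-∀

risingFactorial′-unfoldˡ : ∀ x n →
  risingFactorial′ x (suc n) ≡ risingFactorial (suc x) n ℕ.+ x ℕ.* risingFactorial′ (suc x) n
risingFactorial′-unfoldˡ x zero    = cong (λ y → 1 ℕ.+ y ℕ.* 0) (ℕ.+-identityʳ x)
risingFactorial′-unfoldˡ x (suc n) =
  trans (cong₂ (λ r d → r ℕ.+ (x ℕ.+ suc n) ℕ.* d)
               (risingFactorial-unfoldˡ x n) (risingFactorial′-unfoldˡ x n))
        (product-rule x n (risingFactorial (suc x) n) (risingFactorial′ (suc x) n))
  where
  product-rule : ∀ x n r d → x ℕ.* r ℕ.+ (x ℕ.+ suc n) ℕ.* (r ℕ.+ x ℕ.* d)
                           ≡ (suc x ℕ.+ n) ℕ.* r ℕ.+ x ℕ.* (r ℕ.+ (suc x ℕ.+ n) ℕ.* d)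
  product-rule = ℕ-Solver.solve-∀

risingFactorial′-suc-suc : ∀ x n →
  risingFactorial′ (suc x) (suc n) ≡ suc n ℕ.* risingFactorial′ (suc x) n ℕ.+ risingFactorial′ x (suc n)
risingFactorial′-suc-suc x n =
  trans (regroup x n (risingFactorial (suc x) n) (risingFactorial′ (suc x) n))
        (cong (suc n ℕ.* risingFactorial′ (suc x) n ℕ.+_) (sym (risingFactorial′-unfoldˡ x n)))
  where
  regroup : ∀ x n r d → r ℕ.+ (suc x ℕ.+ n) ℕ.* d ≡ suc n ℕ.* d ℕ.+ (r ℕ.+ x ℕ.* d)
  regroup = ℕ-Solver.solve-∀

risingFactorial-1 : ∀ n → risingFactorial 1 n ≡ n !
risingFactorial-1 zero    = refl
risingFactorial-1 (suc n) = cong (suc n ℕ.*_) (risingFactorial-1 n)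

risingFactorial′-0 : ∀ n → risingFactorial′ 0 (suc n) ≡ n !
risingFactorial′-0 n =
  trans (risingFactorial′-unfoldˡ 0 n) (trans (ℕ.+-identityʳ _) (risingFactorial-1 n))

toℚ-*-invOrZero : ∀ m → toℚ (+ suc m) ℚ.* invOrZero (suc m) ≡ ℚ.1ℚ
toℚ-*-invOrZero m = ℚ.toℚᵘ-injective (begin
  ℚ.toℚᵘ (toℚ (+ suc m) ℚ.* invOrZero (suc m))
    ≈⟨ ℚ.toℚᵘ-homo-* (toℚ (+ suc m)) (invOrZero (suc m)) ⟩
  ℚ.toℚᵘ (toℚ (+ suc m)) ℚᵘ.* ℚ.toℚᵘ (invOrZero (suc m))
    ≈⟨ ℚᵘ.*-cong (toℚᵘ-toℚ (+ suc m)) (ℚ.toℚᵘ-fromℚᵘ (ℚᵘ.mkℚᵘ ℤ.1ℤ m)) ⟩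
  ℚᵘ.mkℚᵘ (+ suc m) 0 ℚᵘ.* ℚᵘ.mkℚᵘ ℤ.1ℤ m
    ≈⟨ ℚᵘ.*≡* (cong ℤ.+[1+_] (cross m)) ⟩
  ℚ.toℚᵘ ℚ.1ℚ
    ∎)
  where
  open ℚᵘ.≃-Reasoning
  cross : ∀ m → m ℕ.* 1 ℕ.* 1 ≡ m ℕ.+ 0 ℕ.* suc m ℕ.+ 0 ℕ.* suc (m ℕ.+ 0 ℕ.* suc m)
  cross = ℕ-Solver.solve-∀

hyperharmonic-0 : ∀ p → hyperharmonic p 0 ≡ ℚ.0ℚ
hyperharmonic-0 zero    = refl
hyperharmonic-0 (suc p) = hyperharmonic-0 p

toℚ-!-*-invOrZero : ∀ m → toℚ (+ (suc m !)) ℚ.* invOrZero (suc m) ≡ toℚ (+ (m !))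
toℚ-!-*-invOrZero m = begin
  toℚ (+ (suc m ℕ.* m !)) ℚ.* I ≡⟨ cong (ℚ._* I) (toℚ-pos-* (suc m) (m !)) ⟩
  M ℚ.* F ℚ.* I                  ≡⟨ cong (ℚ._* I) (ℚ.*-comm M F) ⟩
  F ℚ.* M ℚ.* I                  ≡⟨ ℚ.*-assoc F M I ⟩
  F ℚ.* (M ℚ.* I)                ≡⟨ cong (F ℚ.*_) (toℚ-*-invOrZero m) ⟩
  F ℚ.* ℚ.1ℚ                     ≡⟨ ℚ.*-identityʳ F ⟩
  F                              ∎
  where
  open ≡-Reasoning
  M = toℚ (+ suc m)
  F = toℚ (+ (m !))
  I = invOrZero (suc m)

risingFactorial′-hyperharmonic : ∀ p n →
  toℚ (+ risingFactorial′ p n) ≡ toℚ (+ (n !)) ℚ.* hyperharmonic p n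
risingFactorial′-hyperharmonic zero    zero    = refl
risingFactorial′-hyperharmonic zero    (suc m) =
  trans (cong (λ k → toℚ (+ k)) (risingFactorial′-0 m)) (sym (toℚ-!-*-invOrZero m))
risingFactorial′-hyperharmonic (suc p) zero    = sym (trans (ℚ.*-identityˡ _) (hyperharmonic-0 p))
risingFactorial′-hyperharmonic (suc p) (suc n) = begin
  toℚ (+ risingFactorial′ (suc p) (suc n))
    ≡⟨ cong (λ k → toℚ (+ k)) (risingFactorial′-suc-suc p n) ⟩
  toℚ (+ (suc n ℕ.* D₁ ℕ.+ D₀))
    ≡⟨ trans (toℚ-pos-+ (suc n ℕ.* D₁) D₀) (cong (ℚ._+ toℚ (+ D₀)) (toℚ-pos-* (suc n) D₁)) ⟩
  N ℚ.* toℚ (+ D₁) ℚ.+ toℚ (+ D₀)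
    ≡⟨ cong₂ (λ a b → N ℚ.* a ℚ.+ b)
             (risingFactorial′-hyperharmonic (suc p) n) (risingFactorial′-hyperharmonic p (suc n)) ⟩
  N ℚ.* (F ℚ.* S) ℚ.+ toℚ (+ (suc n ℕ.* n !)) ℚ.* h
    ≡⟨ cong (λ a → N ℚ.* (F ℚ.* S) ℚ.+ a ℚ.* h) (toℚ-pos-* (suc n) (n !)) ⟩
  N ℚ.* (F ℚ.* S) ℚ.+ N ℚ.* F ℚ.* h
    ≡⟨ cong (ℚ._+ N ℚ.* F ℚ.* h) (ℚ.*-assoc N F S) ⟨
  N ℚ.* F ℚ.* S ℚ.+ N ℚ.* F ℚ.* h
    ≡⟨ ℚ.*-distribˡ-+ (N ℚ.* F) S h ⟨
  N ℚ.* F ℚ.* (S ℚ.+ h)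
    ≡⟨ cong (ℚ._* (S ℚ.+ h)) (toℚ-pos-* (suc n) (n !)) ⟨
  toℚ (+ (suc n !)) ℚ.* hyperharmonic (suc p) (suc n)
    ∎
  where
  open ≡-Reasoning
  D₁ = risingFactorial′ (suc p) n
  D₀ = risingFactorial′ p (suc n)
  N = toℚ (+ suc n)
  F = toℚ (+ (n !))
  S = hyperharmonic (suc p) n
  h = hyperharmonic p (suc n)

corollary2 : (p n : ℕ) →
    Σ≤ n (λ k → toℚ (stirling1 n k ℤ.* sgn k ℤ.* ℤ.+ (k ℕ.* p ℕ.^ (k ℕ.∸ 1))))
      ≡ toℚ (sgn n ℤ.* ℤ.+ (n ℕ.!)) ℚ.* hyperharmonic p n
corollary2 p n = begin
  Σ≤ n (λ k → toℚ (stirling1 n k * sgn k * + (k ℕ.* p ℕ.^ (k ∸ 1))))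
    ≡⟨ toℚ-Σℤ≤ n (λ k → stirling1 n k * sgn k * + (k ℕ.* p ℕ.^ (k ∸ 1))) ⟩
  toℚ (Σℤ≤ n (λ k → stirling1 n k * sgn k * + (k ℕ.* p ℕ.^ (k ∸ 1))))
    ≡⟨ cong toℚ (signed-stirling-sum≡risingFactorial′ n p) ⟩
  toℚ (sgn n * + risingFactorial′ p n)
    ≡⟨ toℚ-homo-* (sgn n) (+ risingFactorial′ p n) ⟩
  toℚ (sgn n) ℚ.* toℚ (+ risingFactorial′ p n)
    ≡⟨ cong (toℚ (sgn n) ℚ.*_) (risingFactorial′-hyperharmonic p n) ⟩
  toℚ (sgn n) ℚ.* (toℚ (+ (n !)) ℚ.* hyperharmonic p n)
    ≡⟨ ℚ.*-assoc (toℚ (sgn n)) (toℚ (+ (n !))) (hyperharmonic p n) ⟨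
  toℚ (sgn n) ℚ.* toℚ (+ (n !)) ℚ.* hyperharmonic p n
    ≡⟨ cong (ℚ._* hyperharmonic p n) (toℚ-homo-* (sgn n) (+ (n !))) ⟨
  toℚ (sgn n * + (n !)) ℚ.* hyperharmonic p n
    ∎
  where open ≡-Reasoning
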